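{- For every $n\geq 2$, the distinguishing number of the friendship graph $F_n$ is $$D(F_n)=\left\lceil \frac{1+\sqrt{8n+1}}{2}\right\rceil .$$
   Context: The friendship graph $F_n$ ($n\ge 2$) is obtained by taking $n$ copies of the cycle $C_3$ and identifying one vertex from each copy into a single common vertex. For a graph $G$, a vertex labeling $\phi:V(G)\to\{1,\dots,r\}$ is $r$-distinguishing if the only automorphism $\sigma$ of $G$ with $\phi(\sigma(x))=\phi(x)$ for all $x\in V(G)$ is the identity. The distinguishing number $D(G)$ is the least $r$ such that $G$ has an $r$-distinguishing vertex labeling (labels need not form a proper colouring). -}

module Defs where

open import Data.Nat using (ℕ; zero; suc; _*_; _+_; _∸_; _^_; _≤_; _<_)
open import Data.Fin using (Fin)
open import Data.Bool using (Bool; not)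
open import Data.Product using (Σ; ∃; _×_)
open import Relation.Binary.PropositionalEquality using (_≡_)
open import Relation.Nullary using (¬_)
open import Function.Bundles using (_↔_; _⇔_; Inverse)

record Graph : Set₁ where
  field
    V   : Set
    Adj : V → V → Set

-- Vertices of the friendship graph F_n: the common centre, and for each
-- triangle i : Fin n its two other vertices, indexed by a Bool.
data FV (n : ℕ) : Set where
  centre : FV n
  leaf   : Fin n → Bool → FV n

data FAdj {n : ℕ} : FV n → FV n → Set where
  c-l : ∀ i b → FAdj centre (leaf i b)
  l-c : ∀ i b → FAdj (leaf i b) centre
  l-l : ∀ i b → FAdj (leaf i b) (leaf i (not b))

Friendship : ℕ → Graph
Friendship n = record { V = FV n ; Adj = FAdj }

module _ (G : Graph) where
  open Graph G

  IsAutomorphism : V ↔ V → Set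
  IsAutomorphism σ = ∀ x y → Adj x y ⇔ Adj (Inverse.to σ x) (Inverse.to σ y)

  IsDistinguishing : (r : ℕ) → (V → Fin r) → Set
  IsDistinguishing r φ =
    (σ : V ↔ V) → IsAutomorphism σ →
    (∀ x → φ (Inverse.to σ x) ≡ φ x) →
    ∀ x → Inverse.to σ x ≡ x

  HasDistinguishingLabeling : ℕ → Set
  HasDistinguishingLabeling r = Σ (V → Fin r) (IsDistinguishing r)

  DistinguishingNumberIs : ℕ → Set
  DistinguishingNumberIs r =
    HasDistinguishingLabeling r × (∀ s → s < r → ¬ HasDistinguishingLabeling s)

-- k = ⌈(1 + √(8n+1))/2⌉, expressed without reals: k is the least natural
-- number with 8n+1 ≤ (2k-1)^2 (equivalently √(8n+1) ≤ 2k-1, i.e. (1+√(8n+1))/2 ≤ k).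
IsCeilFormula : ℕ → ℕ → Set
IsCeilFormula n k =
  (8 * n + 1 ≤ (2 * k ∸ 1) ^ 2) × (∀ j → j < k → ¬ (8 * n + 1 ≤ (2 * j ∸ 1) ^ 2))

-- An automorphism of F_n with n ≥ 2 fixes the centre (it is the only vertex whose neighbours are not
-- pairwise adjacent) and so permutes the triangles, possibly flipping each; conversely every permutation
-- of the triangles with flips is an automorphism.  Hence a labeling is distinguishing exactly when the
-- 2n oriented triangles (i, c) carry pairwise distinct ordered label pairs (φ(i,c), φ(i,¬c)).  These
-- pairs have distinct entries, so r labels allow at most r(r-1) of them; conversely n distinct increasing
-- pairs a < b exist whenever n ≤ r(r-1)/2.  Finally 2n ≤ r(r-1) ⇔ 8n+1 ≤ (2r-1)², the ceiling formula.
module Submission where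

open import Defs
open import Data.Nat using (ℕ; zero; suc; _+_; _*_; _∸_; _^_; _≤_; _<_; z≤n; s≤s)
open import Data.Nat.Properties
  using (+-suc; *-assoc; *-comm; *-distribʳ-+; +-cancelʳ-≤; +-monoˡ-≤; *-cancelˡ-≤; *-cancelʳ-≤; *-monoʳ-≤;
         m+n≤o⇒n≤o)
open import Data.Nat.Tactic.RingSolver using (solve)
open import Data.List using (_∷_; [])
open import Data.Fin as Fin using (Fin; zero; suc; toℕ; inject₁; inject≤; fromℕ; splitAt; combine; punchOut)
open import Data.Fin.Properties
  using (_≟_; ¬Fin0; 2↔Bool; *↔×; +↔⊎; injective⇒≤; combine-injective; punchOut-injective;
         inject₁-injective; inject≤-injective; <-asym; fromℕ≢inject₁; toℕ-inject₁; toℕ-fromℕ; inject₁ℕ<)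
open import Data.Fin.Permutation using (Permutation′; _⟨$⟩ʳ_; _⟨$⟩ˡ_; inverseˡ; inverseʳ; transpose)
open import Data.Bool using (Bool; true; false; not; _xor_; _∨_; if_then_else_)
open import Data.Bool.Properties using (not-involutive; not-distribʳ-xor; not-¬)
open import Data.Product using (_×_; _,_; proj₁; proj₂; ∃₂; uncurry)
open import Data.Product.Function.NonDependent.Propositional using (_×-↔_)
open import Data.Sum using (_⊎_; inj₁; inj₂; [_,_]′)
open import Data.Empty using (⊥-elim)
open import Relation.Nullary using (¬_; yes; no; does)
open import Relation.Binary.PropositionalEquality
open import Function.Base using (_∘_)
open import Function.Bundles using (_↔_; _⇔_; mk⇔; mk↔ₛ′; Inverse; Equivalence; Injection)
open import Function.Definitions using (Injective)
open import Function.Construct.Identity using (↔-id)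
open import Function.Construct.Composition using (_↔-∘_)
open import Function.Properties.Inverse using (↔⇒↣)

open Inverse using (to; from)

↔-injective : ∀ {A B : Set} (σ : A ↔ B) → Injective _≡_ _≡_ (to σ)
↔-injective σ = Injection.injective (↔⇒↣ σ)

triangular : ℕ → ℕ
triangular zero    = zero
triangular (suc r) = triangular r + r

triangular-double : ∀ r → triangular (suc r) * 2 ≡ suc r * r
triangular-double zero    = refl
triangular-double (suc r) = begin
  (triangular (suc r) + suc r) * 2       ≡⟨ *-distribʳ-+ 2 (triangular (suc r)) (suc r) ⟩
  triangular (suc r) * 2 + suc r * 2     ≡⟨ cong (_+ suc r * 2) (triangular-double r) ⟩
  (1 + r) * r + (1 + r) * 2              ≡⟨ solve (r ∷ []) ⟩
  (2 + r) * (1 + r)                      ∎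
  where open ≡-Reasoning

odd-square : ∀ r → (2 * suc r ∸ 1) ^ 2 ≡ 4 * (suc r * r) + 1
odd-square r = begin
  (2 * suc r ∸ 1) ^ 2              ≡⟨ cong (_^ 2) (+-suc r (r + 0)) ⟩
  (1 + 2 * r) * ((1 + 2 * r) * 1)  ≡⟨ solve (r ∷ []) ⟩
  4 * ((1 + r) * r) + 1            ∎
  where open ≡-Reasoning

ceilCondition⇔pairBound : ∀ n r → (8 * n + 1 ≤ (2 * suc r ∸ 1) ^ 2) ⇔ (n * 2 ≤ suc r * r)
ceilCondition⇔pairBound n r rewrite odd-square r | *-assoc 4 2 n | *-comm 2 n = mk⇔
  (*-cancelˡ-≤ 4 ∘ +-cancelʳ-≤ 1 _ _)
  (+-monoˡ-≤ 1 ∘ *-monoʳ-≤ 4)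

¬ceilCondition-zero : ∀ n → ¬ (8 * n + 1 ≤ (2 * 0 ∸ 1) ^ 2)
¬ceilCondition-zero n le with () ← m+n≤o⇒n≤o (8 * n) le

least-cong : {P Q : ℕ → Set} → (∀ r → P r ⇔ Q r) → ∀ k →
             (P k × (∀ s → s < k → ¬ P s)) ⇔ (Q k × (∀ s → s < k → ¬ Q s))
least-cong P⇔Q k = mk⇔
  (λ (p , minimal) → Equivalence.to (P⇔Q k) p , λ s s<k → minimal s s<k ∘ Equivalence.from (P⇔Q s))
  (λ (q , minimal) → Equivalence.from (P⇔Q k) q , λ s s<k → minimal s s<k ∘ Equivalence.to (P⇔Q s))

offDiagonal-bound : ∀ {m r} (f : Fin m → Fin (suc r) × Fin (suc r)) →
                    (∀ x → proj₁ (f x) ≢ proj₂ (f x)) → Injective _≡_ _≡_ f → m ≤ suc r * r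
offDiagonal-bound {r = r} f f-offDiagonal f-injective =
  injective⇒≤ (f-injective ∘ encode-injective (f-offDiagonal _) (f-offDiagonal _))
  where
  encode-injective : ∀ {a b a′ b′ : Fin (suc r)} (a≢b : a ≢ b) (a′≢b′ : a′ ≢ b′) →
                     combine a (punchOut a≢b) ≡ combine a′ (punchOut a′≢b′) → (a , b) ≡ (a′ , b′)
  encode-injective {a} {_} {a′} a≢b a′≢b′ e
    with refl , e′ ← combine-injective a (punchOut a≢b) a′ (punchOut a′≢b′) e =
    cong (_ ,_) (punchOut-injective a≢b a′≢b′ e′)

-- Fin (triangular r) enumerates the pairs a < b in Fin r: its last r elements are the pairs (a , r - 1).
increasingPair : ∀ r → Fin (triangular r) → Fin r × Fin r
extendPairs : ∀ r → Fin (triangular r) ⊎ Fin r → Fin (suc r) × Fin (suc r)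
increasingPair zero    ()
increasingPair (suc r) = extendPairs r ∘ splitAt (triangular r)
extendPairs r = [ (λ k → inject₁ (proj₁ (increasingPair r k)) , inject₁ (proj₂ (increasingPair r k)))
                , (λ a → inject₁ a , fromℕ r) ]′

increasingPair-< : ∀ r k → proj₁ (increasingPair r k) Fin.< proj₂ (increasingPair r k)
increasingPair-< zero    ()
increasingPair-< (suc r) k with splitAt (triangular r) k
... | inj₁ k′ = subst₂ _<_ (sym (toℕ-inject₁ _)) (sym (toℕ-inject₁ _)) (increasingPair-< r k′)
... | inj₂ a  = subst (toℕ (inject₁ a) <_) (sym (toℕ-fromℕ r)) (inject₁ℕ< a)

increasingPair-injective : ∀ r → Injective _≡_ _≡_ (increasingPair r)
increasingPair-injective zero    {()}
increasingPair-injective (suc r) e = ↔-injective +↔⊎ (extend-injective _ _ e)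
  where
  extend-injective : ∀ x y → extendPairs r x ≡ extendPairs r y → x ≡ y
  extend-injective (inj₁ k) (inj₁ l) e = cong inj₁ (increasingPair-injective r
    (cong₂ _,_ (inject₁-injective (cong proj₁ e)) (inject₁-injective (cong proj₂ e))))
  extend-injective (inj₁ k) (inj₂ b) e = ⊥-elim (fromℕ≢inject₁ (sym (cong proj₂ e)))
  extend-injective (inj₂ a) (inj₁ l) e = ⊥-elim (fromℕ≢inject₁ (cong proj₂ e))
  extend-injective (inj₂ a) (inj₂ b) e = cong inj₂ (inject₁-injective (cong proj₁ e))

adjacency-preserving⇒isAutomorphism : (G : Graph) (σ : Graph.V G ↔ Graph.V G) →
  (∀ {x y} → Graph.Adj G x y → Graph.Adj G (to σ x) (to σ y)) →
  (∀ {x y} → Graph.Adj G x y → Graph.Adj G (from σ x) (from σ y)) →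
  IsAutomorphism G σ
adjacency-preserving⇒isAutomorphism G σ to-preserves from-preserves x y = mk⇔ to-preserves
  (subst₂ (Graph.Adj G) (Inverse.strictlyInverseʳ σ x) (Inverse.strictlyInverseʳ σ y) ∘ from-preserves)

leaf-injective : ∀ {n} {i j : Fin n} {b c} → leaf i b ≡ leaf j c → (i , b) ≡ (j , c)
leaf-injective refl = refl

leaf-neighbour : ∀ {n} {j : Fin n} {c y} → FAdj (leaf j c) y → y ≡ centre ⊎ y ≡ leaf j (not c)
leaf-neighbour (l-c _ _) = inj₁ refl
leaf-neighbour (l-l _ _) = inj₂ refl

leaf-neighbours-adjacent : ∀ {n} {j : Fin n} {c y z} →
                           FAdj (leaf j c) y → FAdj (leaf j c) z → y ≢ z → FAdj y z
leaf-neighbours-adjacent (l-c _ _) (l-c _ _) y≢z = ⊥-elim (y≢z refl)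
leaf-neighbours-adjacent (l-c _ _) (l-l _ _) _   = c-l _ _
leaf-neighbours-adjacent (l-l _ _) (l-c _ _) _   = l-c _ _
leaf-neighbours-adjacent (l-l _ _) (l-l _ _) y≢z = ⊥-elim (y≢z refl)

xor-cancelˡ : ∀ x b → x xor (x xor b) ≡ b
xor-cancelˡ false b = refl
xor-cancelˡ true  b = not-involutive b

xor-align : ∀ {A : Set} {g h : Bool → A} c d → g c ≡ h d → g (not c) ≡ h (not d) →
            ∀ b → h ((c xor d) xor b) ≡ g b
xor-align false false p q false = sym p
xor-align false false p q true  = sym q
xor-align false true  p q false = sym p
xor-align false true  p q true  = sym q
xor-align true  false p q false = sym q
xor-align true  false p q true  = sym p
xor-align true  true  p q false = sym q
xor-align true  true  p q true  = sym p

xor-cancel-outer : ∀ c d → (c xor d) xor c ≡ d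
xor-cancel-outer false false = refl
xor-cancel-outer false true  = refl
xor-cancel-outer true  false = refl
xor-cancel-outer true  true  = refl

module _ {n : ℕ} where

  triangleMap : (Fin n → Fin n) → (Fin n → Bool) → FV n → FV n
  triangleMap π f centre     = centre
  triangleMap π f (leaf k b) = leaf (π k) (f k xor b)

  triangleMap-preserves-adjacency : ∀ π f {x y} →
                                    FAdj x y → FAdj (triangleMap π f x) (triangleMap π f y)
  triangleMap-preserves-adjacency π f (c-l k b) = c-l _ _
  triangleMap-preserves-adjacency π f (l-c k b) = l-c _ _
  triangleMap-preserves-adjacency π f (l-l k b) =
    subst (FAdj (leaf (π k) (f k xor b)) ∘ leaf (π k)) (not-distribʳ-xor (f k) b) (l-l _ _)

  triangleAut : Permutation′ n → (Fin n → Bool) → FV n ↔ FV n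
  triangleAut π f = mk↔ₛ′ (triangleMap (π ⟨$⟩ʳ_) f) (triangleMap (π ⟨$⟩ˡ_) (f ∘ (π ⟨$⟩ˡ_)))
    to∘from from∘to
    where
    to∘from : ∀ x → triangleMap (π ⟨$⟩ʳ_) f (triangleMap (π ⟨$⟩ˡ_) (f ∘ (π ⟨$⟩ˡ_)) x) ≡ x
    to∘from centre     = refl
    to∘from (leaf k b) = cong₂ leaf (inverseʳ π) (xor-cancelˡ (f (π ⟨$⟩ˡ k)) b)
    from∘to : ∀ x → triangleMap (π ⟨$⟩ˡ_) (f ∘ (π ⟨$⟩ˡ_)) (triangleMap (π ⟨$⟩ʳ_) f x) ≡ x
    from∘to centre = refl
    from∘to (leaf k b) rewrite inverseˡ π {k} = cong (leaf k) (xor-cancelˡ (f k) b)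

  triangleAut-isAutomorphism : ∀ π f → IsAutomorphism (Friendship n) (triangleAut π f)
  triangleAut-isAutomorphism π f = adjacency-preserving⇒isAutomorphism (Friendship n) (triangleAut π f)
    (triangleMap-preserves-adjacency _ _) (triangleMap-preserves-adjacency _ _)

  triangleSwap : Fin n → Fin n → Bool → FV n ↔ FV n
  triangleSwap i j e = triangleAut (transpose i j) (λ k → if does (k ≟ i) ∨ does (k ≟ j) then e else false)

  triangleSwap-leaf : ∀ i j e b → to (triangleSwap i j e) (leaf i b) ≡ leaf j (e xor b)
  triangleSwap-leaf i j e b with i ≟ i
  ... | yes _  = refl
  ... | no i≢i = ⊥-elim (i≢i refl)

  triangleSwap-preserves : ∀ {A : Set} (φ : FV n → A) i j e →
                           (∀ b → φ (leaf j (e xor b)) ≡ φ (leaf i b)) →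
                           ∀ x → φ (to (triangleSwap i j e) x) ≡ φ x
  triangleSwap-preserves φ i j e i↦j centre = refl
  triangleSwap-preserves φ i j e i↦j (leaf k b) with k ≟ i
  ... | yes refl = i↦j b
  ... | no _ with k ≟ j
  ...   | yes refl = sym (trans (cong (φ ∘ leaf k) (sym (xor-cancelˡ e b))) (i↦j (e xor b)))
  ...   | no _     = refl

orientedTriangles : ∀ {n} → Fin (n * 2) ↔ (Fin n × Bool)
orientedTriangles = (↔-id _ ×-↔ 2↔Bool) ↔-∘ *↔×

module _ {n r : ℕ} (φ : FV n → Fin r) where

  orientedLabels : Fin n × Bool → Fin r × Fin r
  orientedLabels (i , c) = φ (leaf i c) , φ (leaf i (not c))

  distinguishing⇒orientedLabels-injective : IsDistinguishing (Friendship n) r φ →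
                                            Injective _≡_ _≡_ orientedLabels
  distinguishing⇒orientedLabels-injective φ-dist {i , c} {j , d} same = sym (leaf-injective (begin
    leaf j d                  ≡⟨ cong (leaf j) (xor-cancel-outer c d) ⟨
    leaf j ((c xor d) xor c)  ≡⟨ triangleSwap-leaf i j (c xor d) c ⟨
    to σ (leaf i c)           ≡⟨ φ-dist σ σ-aut σ-preserves (leaf i c) ⟩
    leaf i c                  ∎))
    where
    open ≡-Reasoning
    σ : FV n ↔ FV n
    σ = triangleSwap i j (c xor d)
    σ-aut : IsAutomorphism (Friendship n) σ
    σ-aut = triangleAut-isAutomorphism (transpose i j) _
    σ-preserves : ∀ x → φ (to σ x) ≡ φ x
    σ-preserves = triangleSwap-preserves φ i j (c xor d)
      (xor-align {g = φ ∘ leaf i} {h = φ ∘ leaf j} c d (cong proj₁ same) (cong proj₂ same))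

  orientedLabels-offDiagonal : Injective _≡_ _≡_ orientedLabels →
                               ∀ t → proj₁ (orientedLabels t) ≢ proj₂ (orientedLabels t)
  orientedLabels-offDiagonal injective (i , c) same = not-¬ refl (cong proj₂ (injective {i , c} {i , not c}
    (cong₂ _,_ same (trans (sym same) (cong (φ ∘ leaf i) (sym (not-involutive c)))))))

distinguishingLabeling⇒pairBound : ∀ {n r} → HasDistinguishingLabeling (Friendship n) (suc r) →
                                   n * 2 ≤ suc r * r
distinguishingLabeling⇒pairBound (φ , φ-dist) =
  offDiagonal-bound (orientedLabels φ ∘ to orientedTriangles)
  (orientedLabels-offDiagonal φ injective ∘ to orientedTriangles) (↔-injective orientedTriangles ∘ injective)
  where
  injective : Injective _≡_ _≡_ (orientedLabels φ)
  injective = distinguishing⇒orientedLabels-injective φ φ-dist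

module _ {m : ℕ} (σ : FV (2 + m) ↔ FV (2 + m)) (σ-aut : IsAutomorphism (Friendship (2 + m)) σ) where

  private
    σ-adj : ∀ {x y} → FAdj x y → FAdj (to σ x) (to σ y)
    σ-adj = Equivalence.to (σ-aut _ _)

  -- Two neighbours of the centre in different triangles are not adjacent,
  -- but any two neighbours of a leaf are.
  centre-not-mapped-to-leaf : ∀ {j c} → to σ centre ≢ leaf j c
  centre-not-mapped-to-leaf {j} {c} σc = nonadjacent (Equivalence.from (σ-aut _ _)
    (leaf-neighbours-adjacent (image-adjacent zero) (image-adjacent (suc zero)) (distinct ∘ ↔-injective σ)))
    where
    image-adjacent : ∀ i → FAdj (leaf j c) (to σ (leaf i false))
    image-adjacent i = subst (λ z → FAdj z (to σ (leaf i false))) σc (σ-adj (c-l i false))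
    nonadjacent : ¬ FAdj {2 + m} (leaf zero false) (leaf (suc zero) false)
    nonadjacent ()
    distinct : leaf {2 + m} zero false ≢ leaf (suc zero) false
    distinct ()

  automorphism-fixes-centre : to σ centre ≡ centre
  automorphism-fixes-centre with to σ centre in σc
  ... | centre   = refl
  ... | leaf j c = ⊥-elim (centre-not-mapped-to-leaf σc)

  leaf-not-mapped-to-centre : ∀ {i b} → to σ (leaf i b) ≢ centre
  leaf-not-mapped-to-centre σℓ with () ← ↔-injective σ (trans σℓ (sym automorphism-fixes-centre))

  automorphism-maps-triangle : ∀ i b → ∃₂ λ j c →
                               to σ (leaf i b) ≡ leaf j c × to σ (leaf i (not b)) ≡ leaf j (not c)
  automorphism-maps-triangle i b with to σ (leaf i b) in σℓ
  ... | centre   = ⊥-elim (leaf-not-mapped-to-centre σℓ)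
  ... | leaf j c with leaf-neighbour (subst (λ z → FAdj z (to σ (leaf i (not b)))) σℓ (σ-adj (l-l i b)))
  ...   | inj₁ σℓ′ = ⊥-elim (leaf-not-mapped-to-centre σℓ′)
  ...   | inj₂ σℓ′ = j , c , refl , σℓ′

orientedLabels-injective⇒distinguishing : ∀ {m r} (φ : FV (2 + m) → Fin r) →
  Injective _≡_ _≡_ (orientedLabels φ) → IsDistinguishing (Friendship (2 + m)) r φ
orientedLabels-injective⇒distinguishing φ injective σ σ-aut φ∘σ≡φ centre = automorphism-fixes-centre σ σ-aut
orientedLabels-injective⇒distinguishing φ injective σ σ-aut φ∘σ≡φ (leaf i b)
  with j , c , σℓ , σℓ′ ← automorphism-maps-triangle σ σ-aut i b =
  trans σℓ (cong (uncurry leaf) (injective (cong₂ _,_ (label σℓ) (label σℓ′))))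
  where
  label : ∀ {x y} → to σ x ≡ y → φ y ≡ φ x
  label {x} σx = trans (cong φ (sym σx)) (φ∘σ≡φ x)

module _ {n r : ℕ} (p : Fin n → Fin (suc r) × Fin (suc r)) where

  -- The centre's label is irrelevant since every automorphism fixes the centre.
  pairLabeling : FV n → Fin (suc r)
  pairLabeling centre         = zero
  pairLabeling (leaf i false) = proj₁ (p i)
  pairLabeling (leaf i true)  = proj₂ (p i)

  pairLabeling-orientedLabels-injective : Injective _≡_ _≡_ p → (∀ i → proj₁ (p i) Fin.< proj₂ (p i)) →
                                          Injective _≡_ _≡_ (orientedLabels pairLabeling)
  pairLabeling-orientedLabels-injective p-injective p-< {i , false} {j , false} e =
    cong (_, false) (p-injective e)
  pairLabeling-orientedLabels-injective p-injective p-< {i , true}  {j , true}  e =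
    cong (_, true) (p-injective (cong₂ _,_ (cong proj₂ e) (cong proj₁ e)))
  pairLabeling-orientedLabels-injective p-injective p-< {i , false} {j , true}  e =
    ⊥-elim (<-asym (subst₂ Fin._<_ (cong proj₁ e) (cong proj₂ e) (p-< i)) (p-< j))
  pairLabeling-orientedLabels-injective p-injective p-< {i , true}  {j , false} e =
    ⊥-elim (<-asym (subst₂ Fin._<_ (cong proj₂ e) (cong proj₁ e) (p-< i)) (p-< j))

pairBound⇒distinguishingLabeling : ∀ {m r} → (2 + m) * 2 ≤ suc r * r →
                                   HasDistinguishingLabeling (Friendship (2 + m)) (suc r)
pairBound⇒distinguishingLabeling {m} {r} bound = pairLabeling p ,
  orientedLabels-injective⇒distinguishing (pairLabeling p)
    (pairLabeling-orientedLabels-injective p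
      (inject≤-injective n≤triangular n≤triangular _ _ ∘ increasingPair-injective (suc r))
      (λ i → increasingPair-< (suc r) (inject≤ i n≤triangular)))
  where
  n≤triangular : 2 + m ≤ triangular (suc r)
  n≤triangular = *-cancelʳ-≤ (2 + m) _ 2 (subst ((2 + m) * 2 ≤_) (sym (triangular-double r)) bound)
  p : Fin (2 + m) → Fin (suc r) × Fin (suc r)
  p i = increasingPair (suc r) (inject≤ i n≤triangular)

hasDistinguishingLabeling⇔ceilCondition : ∀ {n} → 2 ≤ n → ∀ r →
  HasDistinguishingLabeling (Friendship n) r ⇔ (8 * n + 1 ≤ (2 * r ∸ 1) ^ 2)
hasDistinguishingLabeling⇔ceilCondition {n} _ zero =
  mk⇔ (λ (φ , _) → ⊥-elim (¬Fin0 (φ centre))) (⊥-elim ∘ ¬ceilCondition-zero n)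
hasDistinguishingLabeling⇔ceilCondition {n} (s≤s (s≤s z≤n)) (suc r) = mk⇔
  (Equivalence.from (ceilCondition⇔pairBound n r) ∘ distinguishingLabeling⇒pairBound)
  (pairBound⇒distinguishingLabeling ∘ Equivalence.to (ceilCondition⇔pairBound n r))

mainTheorem2 : (n : ℕ) → 2 ≤ n → (k : ℕ) →
    DistinguishingNumberIs (Friendship n) k ⇔ IsCeilFormula n k
mainTheorem2 n 2≤n = least-cong (hasDistinguishingLabeling⇔ceilCondition 2≤n)
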